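{- Let $\varphi$ be a first-order formula. For every integer $n>1$ and every even integer $m>1$: (i) if $NM_n\not\models\varphi$, then $NM_\infty\not\models\varphi$ and $NM'_\infty\not\models\varphi$; (ii) if $NM_m\not\models\varphi$, then $NM^-_\infty\not\models\varphi$ and $NM'^-_\infty\not\models\varphi$.
   Context: All chains are subalgebras of $[0,1]_{\mathrm{NM}}$ (real order, $n(x)=1-x$, $x*y=0$ if $x\le1-y$ and $\min(x,y)$ otherwise, $x\Rightarrow y=1$ if $x\le y$ and $\max(1-x,y)$ otherwise). $NM_n$ has universe $\{0,\frac1{n-1},\dots,\frac{n-2}{n-1},1\}$; $NM_\infty$ has universe $\{\frac1k:k\in\mathbb{N}^+\}\cup\{1-\frac1k:k\in\mathbb{N}^+\}$, $NM^-_\infty$ the same minus $\frac12$; $NM'_\infty$ has universe $\{\frac12-\frac1{2k}:k\in\mathbb{N}^+\}\cup\{\frac12+\frac1{2k}:k\in\mathbb{N}^+\}\cup\{\frac12\}$ and $NM'^-_\infty$ the same minus $\frac12$. Formulas use $\&,\land,\to,\bot,\forall,\exists$ interpreted by $*,\min,\Rightarrow,0$, infimum, supremum. $\mathcal{A}\models\varphi$ means $\varphi$ takes value $1$ under every evaluation in every safe $\mathcal{A}$-model (a model with nonempty domain, maps $M^k\to A$ for $k$-ary predicates, in which all needed infima/suprema exist). -}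

module Defs where

open import Data.Nat as ℕ using (ℕ; zero; suc)
open import Data.Integer using (+_)
open import Data.Rational
  using (ℚ; 0ℚ; 1ℚ; ½; _/_; _-_; _*_; _⊓_; _⊔_; _≤_; _≤ᵇ_)
open import Data.Bool using (if_then_else_)
open import Data.Vec using (Vec; map)
open import Data.Product using (Σ; _×_; ∃-syntax)
open import Data.Sum using (_⊎_)
open import Data.Empty using (⊥)
open import Relation.Nullary using (¬_)
open import Relation.Binary.PropositionalEquality using (_≡_)
open import Data.Nat using (_≟_)
open import Relation.Nullary using (yes; no)

-- The standard Nilpotent Minimum operations on [0,1] ∩ ℚ
-- (all chains considered in the paper consist of rationals)

nm-neg : ℚ → ℚ
nm-neg x = 1ℚ - x

_⊛_ : ℚ → ℚ → ℚ
x ⊛ y = if x ≤ᵇ (1ℚ - y) then 0ℚ else (x ⊓ y)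

_⇛_ : ℚ → ℚ → ℚ
x ⇛ y = if x ≤ᵇ y then 1ℚ else ((1ℚ - x) ⊔ y)

-- Chains (universes, as predicates on ℚ; operations are the NM ones)

Chain : Set₁
Chain = ℚ → Set

-- NM_n : {0, 1/(n-1), ..., (n-2)/(n-1), 1}, i.e. x = k/(n-1) with k ≤ n-1
-- (used only for n > 1)
NMfin : ℕ → Chain
NMfin n x = Σ ℕ λ k → (k ℕ.≤ n ℕ.∸ 1) × (x * ((+ (n ℕ.∸ 1)) / 1) ≡ (+ k) / 1)

-- 1/(k+1) for k : ℕ, i.e. 1/j for j ∈ ℕ⁺
inv : ℕ → ℚ
inv k = (+ 1) / suc k

NMinf : Chain
NMinf x = Σ ℕ λ k → (x ≡ inv k) ⊎ (x ≡ 1ℚ - inv k)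

NMinf⁻ : Chain
NMinf⁻ x = NMinf x × ¬ (x ≡ ½)

NMinf' : Chain
NMinf' x = (Σ ℕ λ k → (x ≡ ½ - (½ * inv k)) ⊎ (x ≡ ½ Data.Rational.+ (½ * inv k))) ⊎ (x ≡ ½)

NMinf'⁻ : Chain
NMinf'⁻ x = NMinf' x × ¬ (x ≡ ½)

record Language : Set₁ where
  field
    Pred  : Set
    arity : Pred → ℕ

open Language public

data Formula (L : Language) : Set where
  atom   : (P : Pred L) → Vec ℕ (arity L P) → Formula L
  ⊥̇      : Formula L
  _&̇_    : Formula L → Formula L → Formula L
  _∧̇_    : Formula L → Formula L → Formula L
  _→̇_    : Formula L → Formula L → Formula L
  ∀̇      : ℕ → Formula L → Formula L
  ∃̇      : ℕ → Formula L → Formula L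

record Structure (L : Language) (A : Chain) : Set₁ where
  field
    Dom      : Set
    inhabit  : Dom
    interp   : (P : Pred L) → Vec Dom (arity L P) → ℚ
    interp∈A : (P : Pred L) (ds : Vec Dom (arity L P)) → A (interp P ds)

open Structure public

_[_↦_] : {D : Set} → (ℕ → D) → ℕ → D → (ℕ → D)
(e [ x ↦ d ]) y with y ≟ x
... | yes _ = d
... | no  _ = e y

IsInf : Chain → (ℚ → Set) → ℚ → Set
IsInf A S v = A v × (∀ w → S w → v ≤ w)
                  × (∀ u → A u → (∀ w → S w → u ≤ w) → u ≤ v)

IsSup : Chain → (ℚ → Set) → ℚ → Set
IsSup A S v = A v × (∀ w → S w → w ≤ v)
                  × (∀ u → A u → (∀ w → S w → w ≤ u) → v ≤ u)

-- Val M φ e v : "the truth value of φ in M under e is v"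
-- (a relation, since infima/suprema need not exist)
Val : {L : Language} {A : Chain} (M : Structure L A) →
      Formula L → (ℕ → Dom M) → ℚ → Set
Val M (atom P xs) e v = v ≡ interp M P (map e xs)
Val M ⊥̇ e v = v ≡ 0ℚ
Val M (φ &̇ ψ) e v = Σ ℚ λ a → Σ ℚ λ b → Val M φ e a × Val M ψ e b × (v ≡ a ⊛ b)
Val M (φ ∧̇ ψ) e v = Σ ℚ λ a → Σ ℚ λ b → Val M φ e a × Val M ψ e b × (v ≡ a ⊓ b)
Val M (φ →̇ ψ) e v = Σ ℚ λ a → Σ ℚ λ b → Val M φ e a × Val M ψ e b × (v ≡ a ⇛ b)
Val {A = A} M (∀̇ x φ) e v = IsInf A (λ w → Σ (Dom M) λ d → Val M φ (e [ x ↦ d ]) w) v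
Val {A = A} M (∃̇ x φ) e v = IsSup A (λ w → Σ (Dom M) λ d → Val M φ (e [ x ↦ d ]) w) v

Safe : {L : Language} {A : Chain} → Structure L A → Set
Safe {L} M = (φ : Formula L) (e : ℕ → Dom M) → Σ ℚ λ v → Val M φ e v

_⊨_ : {L : Language} → Chain → Formula L → Set₁
_⊨_ {L} A φ = (M : Structure L A) → Safe M →
              (e : ℕ → Dom M) (v : ℚ) → Val M φ e v → v ≡ 1ℚ

Even : ℕ → Set
Even m = Σ ℕ λ k → m ≡ 2 ℕ.* k

-- Write N = n − 1, so that NM_n enumerates as k ↦ k/N (k ≤ N). Any strictly
-- increasing h on {0,…,N} with h 0 = 0, h N = 1 and 1 − h k = h (N ∸ k) transports
-- the NM operations of NM_n to those on its image, since each operation is computed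
-- on indices alone. The same holds for infima and suprema of value sets, provided
-- the target chain B lies in [0,1]: were the image of an infimum not the infimum in
-- B, the next element of NM_n would be a larger lower bound in NM_n. So a
-- countermodel over NM_n, reindexed along h, is a countermodel over B. Such h into
-- NM_∞ and NM'_∞ arise by mirroring about ½ an increasing sequence below ½; for N
-- odd (n even) the midpoint ½ is never hit, which gives the chains without ½.
module Submission where

open import Data.Nat as ℕ using (ℕ; zero; suc; _∸_; z≤n; s≤s)
import Data.Nat.Properties as ℕₚ
open import Data.Nat.Tactic.RingSolver using (solve-∀)
open import Data.Integer as ℤ using (+_)
import Data.Integer.Properties as ℤₚ
open import Data.Rational
  using (ℚ; 0ℚ; 1ℚ; ½; _/_; _+_; _-_; _*_; _⊓_; _⊔_; _≤_; _<_; _≤ᵇ_; toℚᵘ)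
import Data.Rational.Properties as ℚₚ
import Data.Rational.Unnormalised as ℚᵘ
import Data.Rational.Unnormalised.Properties as ℚᵘₚ
open import Data.Rational.Solver using (module +-*-Solver)
open import Data.Bool using (true; false)
open import Data.Unit using (tt)
open import Data.Product using (Σ; _×_; _,_; proj₁; proj₂)
open import Data.Sum using (inj₁; inj₂)
open import Data.Empty using (⊥-elim)
open import Data.Vec using (map)
open import Function using (_∘_)
open import Relation.Nullary using (¬_; yes; no)
open import Relation.Binary.Definitions using (tri<; tri≈; tri>)
open import Relation.Binary.PropositionalEquality
open import Defs

fraction : ℕ → ℕ → ℚ
fraction p q = + p / suc q

toℚᵘ-fraction : ∀ p q → toℚᵘ (fraction p q) ℚᵘ.≃ ℚᵘ.mkℚᵘ (+ p) q
toℚᵘ-fraction p q = ℚₚ.toℚᵘ-fromℚᵘ (ℚᵘ.mkℚᵘ (+ p) q)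

fraction-cong : ∀ p q p′ q′ → p ℕ.* suc q′ ≡ p′ ℕ.* suc q → fraction p q ≡ fraction p′ q′
fraction-cong p q p′ q′ eq = ℚₚ.toℚᵘ-injective
  (ℚᵘₚ.≃-trans (toℚᵘ-fraction p q) (ℚᵘₚ.≃-trans (ℚᵘ.*≡* cross) (ℚᵘₚ.≃-sym (toℚᵘ-fraction p′ q′))))
  where
  cross : + p ℤ.* + suc q′ ≡ + p′ ℤ.* + suc q
  cross = trans (sym (ℤₚ.pos-* p (suc q′))) (trans (cong +_ eq) (ℤₚ.pos-* p′ (suc q)))

fraction-mono-< : ∀ p q p′ q′ → p ℕ.* suc q′ ℕ.< p′ ℕ.* suc q → fraction p q < fraction p′ q′
fraction-mono-< p q p′ q′ lt = ℚₚ.toℚᵘ-cancel-<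
  (ℚᵘₚ.<-respˡ-≃ (ℚᵘₚ.≃-sym (toℚᵘ-fraction p q))
    (ℚᵘₚ.<-respʳ-≃ (ℚᵘₚ.≃-sym (toℚᵘ-fraction p′ q′)) (ℚᵘ.*<* cross)))
  where
  cross : + p ℤ.* + suc q′ ℤ.< + p′ ℤ.* + suc q
  cross = subst₂ ℤ._<_ (ℤₚ.pos-* p (suc q′)) (ℤₚ.pos-* p′ (suc q)) (ℤ.+<+ lt)

fraction-mono-≤ : ∀ p q p′ q′ → p ℕ.* suc q′ ℕ.≤ p′ ℕ.* suc q → fraction p q ≤ fraction p′ q′
fraction-mono-≤ p q p′ q′ le = ℚₚ.toℚᵘ-cancel-≤
  (ℚᵘₚ.≤-respˡ-≃ (ℚᵘₚ.≃-sym (toℚᵘ-fraction p q))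
    (ℚᵘₚ.≤-respʳ-≃ (ℚᵘₚ.≃-sym (toℚᵘ-fraction p′ q′)) (ℚᵘ.*≤* cross)))
  where
  cross : + p ℤ.* + suc q′ ℤ.≤ + p′ ℤ.* + suc q
  cross = subst₂ ℤ._≤_ (ℤₚ.pos-* p (suc q′)) (ℤₚ.pos-* p′ (suc q)) (ℤ.+≤+ le)

-- The denominators are written so that their successors are the products suc b * suc d.
fraction-* : ∀ a b c d → fraction a b * fraction c d ≡ fraction (a ℕ.* c) (d ℕ.+ b ℕ.* suc d)
fraction-* a b c d = ℚₚ.toℚᵘ-injective
  (ℚᵘₚ.≃-trans (ℚₚ.toℚᵘ-homo-* (fraction a b) (fraction c d))
  (ℚᵘₚ.≃-trans (ℚᵘₚ.*-cong (toℚᵘ-fraction a b) (toℚᵘ-fraction c d))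
  (ℚᵘₚ.≃-trans (ℚᵘ.*≡* (cong (ℤ._* + suc (d ℕ.+ b ℕ.* suc d)) (sym (ℤₚ.pos-* a c))))
  (ℚᵘₚ.≃-sym (toℚᵘ-fraction (a ℕ.* c) (d ℕ.+ b ℕ.* suc d))))))

fraction-+ : ∀ a b c d →
  fraction a b + fraction c d ≡ fraction (a ℕ.* suc d ℕ.+ c ℕ.* suc b) (d ℕ.+ b ℕ.* suc d)
fraction-+ a b c d = ℚₚ.toℚᵘ-injective
  (ℚᵘₚ.≃-trans (ℚₚ.toℚᵘ-homo-+ (fraction a b) (fraction c d))
  (ℚᵘₚ.≃-trans (ℚᵘₚ.+-cong (toℚᵘ-fraction a b) (toℚᵘ-fraction c d))
  (ℚᵘₚ.≃-trans (ℚᵘ.*≡* (cong (ℤ._* + suc (d ℕ.+ b ℕ.* suc d)) numerator))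
  (ℚᵘₚ.≃-sym (toℚᵘ-fraction (a ℕ.* suc d ℕ.+ c ℕ.* suc b) (d ℕ.+ b ℕ.* suc d))))))
  where
  numerator : + a ℤ.* + suc d ℤ.+ + c ℤ.* + suc b ≡ + (a ℕ.* suc d ℕ.+ c ℕ.* suc b)
  numerator = trans (cong₂ ℤ._+_ (sym (ℤₚ.pos-* a (suc d))) (sym (ℤₚ.pos-* c (suc b))))
                    (sym (ℤₚ.pos-+ (a ℕ.* suc d) (c ℕ.* suc b)))

<⇒≱ : ∀ {p q} → p < q → ¬ (q ≤ p)
<⇒≱ p<q q≤p = ℚₚ.<-irrefl refl (ℚₚ.<-≤-trans p<q q≤p)

sub-antimonoʳ-< : ∀ c {p q} → p < q → c - q < c - p
sub-antimonoʳ-< c p<q = ℚₚ.+-monoʳ-< c (ℚₚ.neg-antimono-< p<q)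

sub-antimonoʳ-≤ : ∀ c {p q} → p ≤ q → c - q ≤ c - p
sub-antimonoʳ-≤ c p≤q = ℚₚ.+-monoʳ-≤ c (ℚₚ.neg-antimono-≤ p≤q)

1-[1-p]≡p : ∀ p → 1ℚ - (1ℚ - p) ≡ p
1-[1-p]≡p = solve 1 (λ p → con 1ℚ :- (con 1ℚ :- p) := p) refl
  where open +-*-Solver

p+q≡1⇒1-p≡q : ∀ {p q} → p + q ≡ 1ℚ → 1ℚ - p ≡ q
p+q≡1⇒1-p≡q {p} {q} eq =
  trans (cong (_- p) (sym eq)) (solve 2 (λ p q → (p :+ q) :- p := q) refl p q)
  where open +-*-Solver

0<½ : 0ℚ < ½
0<½ = fraction-mono-< 0 0 1 1 (s≤s z≤n)

½≤1 : ½ ≤ 1ℚ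
½≤1 = fraction-mono-≤ 1 1 1 0 (s≤s z≤n)

p<½⇒½<1-p : ∀ {p} → p < ½ → ½ < 1ℚ - p
p<½⇒½<1-p = sub-antimonoʳ-< 1ℚ

p≤1-q⇒p⊛q≡0 : ∀ {p q} → p ≤ 1ℚ - q → p ⊛ q ≡ 0ℚ
p≤1-q⇒p⊛q≡0 {p} {q} le with p ≤ᵇ (1ℚ - q) | ℚₚ.≤⇒≤ᵇ le
... | true | _ = refl

p≰1-q⇒p⊛q≡p⊓q : ∀ {p q} → ¬ (p ≤ 1ℚ - q) → p ⊛ q ≡ p ⊓ q
p≰1-q⇒p⊛q≡p⊓q {p} {q} nle with p ≤ᵇ (1ℚ - q) | ℚₚ.≤ᵇ⇒≤ {p} {1ℚ - q}
... | true  | le = ⊥-elim (nle (le tt))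
... | false | _  = refl

p≤q⇒p⇛q≡1 : ∀ {p q} → p ≤ q → p ⇛ q ≡ 1ℚ
p≤q⇒p⇛q≡1 {p} {q} le with p ≤ᵇ q | ℚₚ.≤⇒≤ᵇ le
... | true | _ = refl

p≰q⇒p⇛q≡[1-p]⊔q : ∀ {p q} → ¬ (p ≤ q) → p ⇛ q ≡ (1ℚ - p) ⊔ q
p≰q⇒p⇛q≡[1-p]⊔q {p} {q} nle with p ≤ᵇ q | ℚₚ.≤ᵇ⇒≤ {p} {q}
... | true  | le = ⊥-elim (nle (le tt))
... | false | _  = refl

conjᴵ : ℕ → ℕ → ℕ → ℕ
conjᴵ N i j with i ℕ.≤? N ∸ j
... | yes _ = 0
... | no  _ = i ℕ.⊓ j

implᴵ : ℕ → ℕ → ℕ → ℕ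
implᴵ N i j with i ℕ.≤? j
... | yes _ = N
... | no  _ = (N ∸ i) ℕ.⊔ j

conjᴵ-≤ : ∀ {N i j} → i ℕ.≤ N → j ℕ.≤ N → conjᴵ N i j ℕ.≤ N
conjᴵ-≤ {N} {i} {j} i≤N _ with i ℕ.≤? N ∸ j
... | yes _ = z≤n
... | no  _ = ℕₚ.≤-trans (ℕₚ.m⊓n≤m i j) i≤N

⊓-≤ : ∀ {N i j} → i ℕ.≤ N → j ℕ.≤ N → i ℕ.⊓ j ℕ.≤ N
⊓-≤ {i = i} {j} i≤N _ = ℕₚ.≤-trans (ℕₚ.m⊓n≤m i j) i≤N

implᴵ-≤ : ∀ {N i j} → i ℕ.≤ N → j ℕ.≤ N → implᴵ N i j ℕ.≤ N
implᴵ-≤ {N} {i} {j} _ j≤N with i ℕ.≤? j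
... | yes _ = ℕₚ.≤-refl
... | no  _ = ℕₚ.⊔-lub (ℕₚ.m∸n≤m N i) j≤N

record IsFiniteNMChain (N : ℕ) (f : ℕ → ℚ) : Set where
  field
    mono-<   : ∀ {j k} → j ℕ.< k → k ℕ.≤ N → f j < f k
    negation : ∀ {k} → k ℕ.≤ N → 1ℚ - f k ≡ f (N ∸ k)
    bottom   : f 0 ≡ 0ℚ
    top      : f N ≡ 1ℚ

  mono-≤ : ∀ {j k} → j ℕ.≤ k → k ℕ.≤ N → f j ≤ f k
  mono-≤ {j} {k} j≤k k≤N with j ℕ.≟ k
  ... | yes refl = ℚₚ.≤-refl
  ... | no  j≢k  = ℚₚ.<⇒≤ (mono-< (ℕₚ.≤∧≢⇒< j≤k j≢k) k≤N)

  cancel-≤ : ∀ {j k} → j ℕ.≤ N → f j ≤ f k → j ℕ.≤ k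
  cancel-≤ {j} {k} j≤N le with j ℕ.≤? k
  ... | yes j≤k = j≤k
  ... | no  j≰k = ⊥-elim (<⇒≱ (mono-< (ℕₚ.≰⇒> j≰k) j≤N) le)

  cancel-< : ∀ {j k} → j ℕ.≤ N → f j < f k → j ℕ.< k
  cancel-< {j} {k} j≤N lt with k ℕ.≤? j
  ... | yes k≤j = ⊥-elim (<⇒≱ lt (mono-≤ k≤j j≤N))
  ... | no  k≰j = ℕₚ.≰⇒> k≰j

  injective : ∀ {j k} → j ℕ.≤ N → k ℕ.≤ N → f j ≡ f k → j ≡ k
  injective j≤N k≤N eq =
    ℕₚ.≤-antisym (cancel-≤ j≤N (ℚₚ.≤-reflexive eq)) (cancel-≤ k≤N (ℚₚ.≤-reflexive (sym eq)))

  ⊓-homo : ∀ {i j} → i ℕ.≤ N → j ℕ.≤ N → f i ⊓ f j ≡ f (i ℕ.⊓ j)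
  ⊓-homo {i} {j} i≤N j≤N with i ℕ.≤? j
  ... | yes i≤j = trans (ℚₚ.p≤q⇒p⊓q≡p (mono-≤ i≤j j≤N)) (cong f (sym (ℕₚ.m≤n⇒m⊓n≡m i≤j)))
  ... | no  i≰j = let j≤i = ℕₚ.<⇒≤ (ℕₚ.≰⇒> i≰j) in
    trans (ℚₚ.p≥q⇒p⊓q≡q (mono-≤ j≤i i≤N)) (cong f (sym (ℕₚ.m≥n⇒m⊓n≡n j≤i)))

  ⊔-homo : ∀ {i j} → i ℕ.≤ N → j ℕ.≤ N → f i ⊔ f j ≡ f (i ℕ.⊔ j)
  ⊔-homo {i} {j} i≤N j≤N with i ℕ.≤? j
  ... | yes i≤j = trans (ℚₚ.p≤q⇒p⊔q≡q (mono-≤ i≤j j≤N)) (cong f (sym (ℕₚ.m≤n⇒m⊔n≡n i≤j)))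
  ... | no  i≰j = let j≤i = ℕₚ.<⇒≤ (ℕₚ.≰⇒> i≰j) in
    trans (ℚₚ.p≥q⇒p⊔q≡p (mono-≤ j≤i i≤N)) (cong f (sym (ℕₚ.m≥n⇒m⊔n≡m j≤i)))

  ⊛-homo : ∀ {i j} → i ℕ.≤ N → j ℕ.≤ N → f i ⊛ f j ≡ f (conjᴵ N i j)
  ⊛-homo {i} {j} i≤N j≤N with i ℕ.≤? N ∸ j
  ... | yes i≤N∸j = trans (p≤1-q⇒p⊛q≡0 fi≤1-fj) (sym bottom)
    where
    fi≤1-fj : f i ≤ 1ℚ - f j
    fi≤1-fj = subst (f i ≤_) (sym (negation j≤N)) (mono-≤ i≤N∸j (ℕₚ.m∸n≤m N j))
  ... | no  i≰N∸j = trans (p≰1-q⇒p⊛q≡p⊓q fi≰1-fj) (⊓-homo i≤N j≤N)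
    where
    fi≰1-fj : ¬ (f i ≤ 1ℚ - f j)
    fi≰1-fj le = i≰N∸j (cancel-≤ i≤N (subst (f i ≤_) (negation j≤N) le))

  ⇛-homo : ∀ {i j} → i ℕ.≤ N → j ℕ.≤ N → f i ⇛ f j ≡ f (implᴵ N i j)
  ⇛-homo {i} {j} i≤N j≤N with i ℕ.≤? j
  ... | yes i≤j = trans (p≤q⇒p⇛q≡1 (mono-≤ i≤j j≤N)) (sym top)
  ... | no  i≰j = begin
    f i ⇛ f j              ≡⟨ p≰q⇒p⇛q≡[1-p]⊔q (i≰j ∘ cancel-≤ i≤N) ⟩
    (1ℚ - f i) ⊔ f j       ≡⟨ cong (_⊔ f j) (negation i≤N) ⟩
    f (N ∸ i) ⊔ f j        ≡⟨ ⊔-homo (ℕₚ.m∸n≤m N i) j≤N ⟩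
    f ((N ∸ i) ℕ.⊔ j)      ∎
    where open ≡-Reasoning

k+k<n⇒n<[n∸k]+[n∸k] : ∀ {n k} → k ℕ.≤ n → k ℕ.+ k ℕ.< n → n ℕ.< (n ∸ k) ℕ.+ (n ∸ k)
k+k<n⇒n<[n∸k]+[n∸k] {n} {k} k≤n k+k<n =
  subst (ℕ._< n ∸ k ℕ.+ (n ∸ k)) (ℕₚ.m∸n+n≡m k≤n) (ℕₚ.+-monoʳ-< (n ∸ k) k<n∸k)
  where
  k<n∸k : k ℕ.< n ∸ k
  k<n∸k = ℕₚ.+-cancelʳ-< k k (n ∸ k) (subst (k ℕ.+ k ℕ.<_) (sym (ℕₚ.m∸n+n≡m k≤n)) k+k<n)

k+k≡n⇒[n∸k]+[n∸k]≡n : ∀ {n k} → k ℕ.≤ n → k ℕ.+ k ≡ n → (n ∸ k) ℕ.+ (n ∸ k) ≡ n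
k+k≡n⇒[n∸k]+[n∸k]≡n {n} {k} k≤n k+k≡n =
  trans (cong ((n ∸ k) ℕ.+_) (sym k≡n∸k)) (ℕₚ.m∸n+n≡m k≤n)
  where
  k≡n∸k : k ≡ n ∸ k
  k≡n∸k = ℕₚ.+-cancelʳ-≡ k k (n ∸ k) (trans k+k≡n (sym (ℕₚ.m∸n+n≡m k≤n)))

n<k+k⇒[n∸k]+[n∸k]<n : ∀ {n k} → k ℕ.≤ n → n ℕ.< k ℕ.+ k → (n ∸ k) ℕ.+ (n ∸ k) ℕ.< n
n<k+k⇒[n∸k]+[n∸k]<n {n} {k} k≤n n<k+k =
  subst ((n ∸ k) ℕ.+ (n ∸ k) ℕ.<_) (ℕₚ.m∸n+n≡m k≤n) (ℕₚ.+-monoʳ-< (n ∸ k) n∸k<k)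
  where
  n∸k<k : n ∸ k ℕ.< k
  n∸k<k = ℕₚ.+-cancelʳ-< k (n ∸ k) k (subst (ℕ._< k ℕ.+ k) (sym (ℕₚ.m∸n+n≡m k≤n)) n<k+k)

module Mirror (N : ℕ) (0<N : 0 ℕ.< N) (low : ℕ → ℚ)
  (low-mono : ∀ {j k} → j ℕ.< k → k ℕ.+ k ℕ.< N → low j < low k)
  (low<½ : ∀ {k} → k ℕ.+ k ℕ.< N → low k < ½)
  (low0≡0 : low 0 ≡ 0ℚ) where

  mirrored : ℕ → ℚ
  mirrored k with ℕₚ.<-cmp (k ℕ.+ k) N
  ... | tri< _ _ _ = low k
  ... | tri≈ _ _ _ = ½
  ... | tri> _ _ _ = 1ℚ - low (N ∸ k)

  mirrored-lower : ∀ {k} → k ℕ.+ k ℕ.< N → mirrored k ≡ low k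
  mirrored-lower {k} k+k<N with ℕₚ.<-cmp (k ℕ.+ k) N
  ... | tri< _ _ _   = refl
  ... | tri≈ k+k≮N _ _ = ⊥-elim (k+k≮N k+k<N)
  ... | tri> k+k≮N _ _ = ⊥-elim (k+k≮N k+k<N)

  mirrored-middle : ∀ {k} → k ℕ.+ k ≡ N → mirrored k ≡ ½
  mirrored-middle {k} k+k≡N with ℕₚ.<-cmp (k ℕ.+ k) N
  ... | tri< _ k+k≢N _ = ⊥-elim (k+k≢N k+k≡N)
  ... | tri≈ _ _ _     = refl
  ... | tri> _ k+k≢N _ = ⊥-elim (k+k≢N k+k≡N)

  mirrored-upper : ∀ {k} → N ℕ.< k ℕ.+ k → mirrored k ≡ 1ℚ - low (N ∸ k)
  mirrored-upper {k} N<k+k with ℕₚ.<-cmp (k ℕ.+ k) N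
  ... | tri< _ _ N≮k+k = ⊥-elim (N≮k+k N<k+k)
  ... | tri≈ _ _ N≮k+k = ⊥-elim (N≮k+k N<k+k)
  ... | tri> _ _ _     = refl

  private
    low<1-low : ∀ {j k} → j ℕ.+ j ℕ.< N → k ℕ.+ k ℕ.< N → low j < 1ℚ - low k
    low<1-low j+j<N k+k<N = ℚₚ.<-trans (low<½ j+j<N) (p<½⇒½<1-p (low<½ k+k<N))

    j+j<k+k : ∀ {j k} → j ℕ.< k → j ℕ.+ j ℕ.< k ℕ.+ k
    j+j<k+k j<k = ℕₚ.+-mono-< j<k j<k

  mirrored-mono : ∀ {j k} → j ℕ.< k → k ℕ.≤ N → mirrored j < mirrored k
  mirrored-mono {j} {k} j<k k≤N with ℕₚ.<-cmp (j ℕ.+ j) N | ℕₚ.<-cmp (k ℕ.+ k) N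
  ... | tri< _ _ _  | tri< lk _ _ = low-mono j<k lk
  ... | tri< lj _ _ | tri≈ _ _ _  = low<½ lj
  ... | tri< lj _ _ | tri> _ _ uk = low<1-low lj (n<k+k⇒[n∸k]+[n∸k]<n k≤N uk)
  ... | tri≈ _ mj _ | tri< lk _ _ = ⊥-elim (ℕₚ.<-asym (subst (ℕ._< k ℕ.+ k) mj (j+j<k+k j<k)) lk)
  ... | tri≈ _ mj _ | tri≈ _ mk _ = ⊥-elim (ℕₚ.<-irrefl (trans mj (sym mk)) (j+j<k+k j<k))
  ... | tri≈ _ _ _  | tri> _ _ uk = p<½⇒½<1-p (low<½ (n<k+k⇒[n∸k]+[n∸k]<n k≤N uk))
  ... | tri> _ _ uj | tri< lk _ _ = ⊥-elim (ℕₚ.<-asym (ℕₚ.<-trans uj (j+j<k+k j<k)) lk)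
  ... | tri> _ _ uj | tri≈ _ mk _ = ⊥-elim (ℕₚ.<-asym uj (subst (j ℕ.+ j ℕ.<_) mk (j+j<k+k j<k)))
  ... | tri> _ _ uj | tri> _ _ _  = sub-antimonoʳ-< 1ℚ
    (low-mono (ℕₚ.∸-monoʳ-< j<k k≤N) (n<k+k⇒[n∸k]+[n∸k]<n (ℕₚ.≤-trans (ℕₚ.<⇒≤ j<k) k≤N) uj))
  mirrored-negation : ∀ {k} → k ℕ.≤ N → 1ℚ - mirrored k ≡ mirrored (N ∸ k)
  mirrored-negation {k} k≤N with ℕₚ.<-cmp (k ℕ.+ k) N
  ... | tri< lk _ _ = sym (trans (mirrored-upper {N ∸ k} (k+k<n⇒n<[n∸k]+[n∸k] k≤N lk))
                                 (cong (λ i → 1ℚ - low i) (ℕₚ.m∸[m∸n]≡n k≤N)))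
  ... | tri≈ _ mk _ = sym (mirrored-middle {N ∸ k} (k+k≡n⇒[n∸k]+[n∸k]≡n k≤N mk))
  ... | tri> _ _ uk =
    trans (1-[1-p]≡p _) (sym (mirrored-lower {N ∸ k} (n<k+k⇒[n∸k]+[n∸k]<n k≤N uk)))

  mirrored-isFiniteNMChain : IsFiniteNMChain N mirrored
  mirrored-isFiniteNMChain = record
    { mono-<   = mirrored-mono
    ; negation = mirrored-negation
    ; bottom   = trans (mirrored-lower {0} 0<N) low0≡0
    ; top      = begin
        mirrored N         ≡⟨ mirrored-upper {N} (ℕₚ.m<m+n N 0<N) ⟩
        1ℚ - low (N ∸ N)   ≡⟨ cong (λ i → 1ℚ - low i) (ℕₚ.n∸n≡0 N) ⟩
        1ℚ - low 0         ≡⟨ cong (1ℚ -_) low0≡0 ⟩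
        1ℚ                 ∎
    }
    where open ≡-Reasoning

  mirrored-∈ : (B : Chain) → B ½ → (∀ {k} → k ℕ.+ k ℕ.< N → B (low k)) →
               (∀ {k} → k ℕ.+ k ℕ.< N → B (1ℚ - low k)) → ∀ {k} → k ℕ.≤ N → B (mirrored k)
  mirrored-∈ B B½ B-low B-1-low {k} k≤N with ℕₚ.<-cmp (k ℕ.+ k) N
  ... | tri< lk _ _ = B-low lk
  ... | tri≈ _ _ _  = B½
  ... | tri> _ _ uk = B-1-low (n<k+k⇒[n∸k]+[n∸k]<n k≤N uk)

  mirrored≢½ : (∀ k → k ℕ.+ k ≢ N) → ∀ {k} → k ℕ.≤ N → mirrored k ≢ ½
  mirrored≢½ N-odd {k} k≤N with ℕₚ.<-cmp (k ℕ.+ k) N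
  ... | tri< lk _ _ = ℚₚ.<⇒≢ (low<½ lk)
  ... | tri≈ _ mk _ = ⊥-elim (N-odd k mk)
  ... | tri> _ _ uk = ≢-sym (ℚₚ.<⇒≢ (p<½⇒½<1-p (low<½ (n<k+k⇒[n∸k]+[n∸k]<n k≤N uk))))

-- NM_{n+2} = {k/(n+1) : k ≤ n+1}.
module Uniform (n : ℕ) where

  uniform : ℕ → ℚ
  uniform k = fraction k n

  uniform-negation : ∀ {k} → k ℕ.≤ suc n → 1ℚ - uniform k ≡ uniform (suc n ∸ k)
  uniform-negation {k} k≤N = p+q≡1⇒1-p≡q {uniform k} (begin
    uniform k + uniform (N ∸ k)  ≡⟨ fraction-+ k n (N ∸ k) n ⟩
    fraction sum (n ℕ.+ n ℕ.* N) ≡⟨ fraction-cong sum (n ℕ.+ n ℕ.* N) 1 0 cross ⟩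
    1ℚ                           ∎)
    where
    open ≡-Reasoning
    N = suc n
    sum = k ℕ.* N ℕ.+ (N ∸ k) ℕ.* N
    N*N≡1*[N*N] : ∀ n → suc n ℕ.* suc n ≡ 1 ℕ.* suc (n ℕ.+ n ℕ.* suc n)
    N*N≡1*[N*N] = solve-∀
    cross : sum ℕ.* 1 ≡ 1 ℕ.* suc (n ℕ.+ n ℕ.* N)
    cross = begin
      sum ℕ.* 1                         ≡⟨ ℕₚ.*-identityʳ sum ⟩
      k ℕ.* N ℕ.+ (N ∸ k) ℕ.* N         ≡⟨ ℕₚ.*-distribʳ-+ N k (N ∸ k) ⟨
      (k ℕ.+ (N ∸ k)) ℕ.* N             ≡⟨ cong (ℕ._* N) (ℕₚ.m+[n∸m]≡n k≤N) ⟩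
      N ℕ.* N                           ≡⟨ N*N≡1*[N*N] n ⟩
      1 ℕ.* suc (n ℕ.+ n ℕ.* N)         ∎

  uniform-isFiniteNMChain : IsFiniteNMChain (suc n) uniform
  uniform-isFiniteNMChain = record
    { mono-<   = λ {j} {k} j<k _ → fraction-mono-< j n k n (ℕₚ.*-monoˡ-< (suc n) j<k)
    ; negation = uniform-negation
    ; bottom   = fraction-cong 0 n 0 0 refl
    ; top      = fraction-cong (suc n) n 1 0 (N*1≡1*N n)
    }
    where
    N*1≡1*N : ∀ n → suc n ℕ.* 1 ≡ 1 ℕ.* suc n
    N*1≡1*N = solve-∀

  uniform-∈ : ∀ {k} → k ℕ.≤ suc n → NMfin (suc (suc n)) (uniform k)
  uniform-∈ {k} k≤N = k , k≤N ,
    trans (fraction-* k n (suc n) 0) (fraction-cong (k ℕ.* suc n) (n ℕ.* 1) k 0 (cross k n))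
    where
    cross : ∀ k n → k ℕ.* suc n ℕ.* 1 ≡ k ℕ.* suc (n ℕ.* 1)
    cross = solve-∀

  uniform-onto : ∀ {x} → NMfin (suc (suc n)) x → Σ ℕ λ k → k ℕ.≤ suc n × x ≡ uniform k
  uniform-onto {x} (k , k≤N , x*N≡k) = k , k≤N , (begin
    x                                       ≡⟨ ℚₚ.*-identityʳ x ⟨
    x * 1ℚ                                  ≡⟨ cong (x *_) N*[1/N]≡1 ⟨
    x * (fraction (suc n) 0 * fraction 1 n) ≡⟨ ℚₚ.*-assoc x _ _ ⟨
    x * fraction (suc n) 0 * fraction 1 n   ≡⟨ cong (_* fraction 1 n) x*N≡k ⟩
    fraction k 0 * fraction 1 n             ≡⟨ fraction-* k 0 1 n ⟩
    fraction (k ℕ.* 1) (n ℕ.+ 0)            ≡⟨ fraction-cong (k ℕ.* 1) (n ℕ.+ 0) k n (k*1*N≡k*N k n) ⟩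
    uniform k                               ∎)
    where
    open ≡-Reasoning
    N*1*1≡1*N : ∀ n → suc n ℕ.* 1 ℕ.* 1 ≡ 1 ℕ.* suc (n ℕ.+ 0)
    N*1*1≡1*N = solve-∀
    N*[1/N]≡1 : fraction (suc n) 0 * fraction 1 n ≡ 1ℚ
    N*[1/N]≡1 =
      trans (fraction-* (suc n) 0 1 n) (fraction-cong (suc n ℕ.* 1) (n ℕ.+ 0) 1 0 (N*1*1≡1*N n))
    k*1*N≡k*N : ∀ k n → k ℕ.* 1 ℕ.* suc n ≡ k ℕ.* suc (n ℕ.+ 0)
    k*1*N≡k*N = solve-∀

Val-functional : ∀ {L A} (M : Structure L A) (φ : Formula L) (e : ℕ → Dom M) {v w : ℚ} →
                 Val M φ e v → Val M φ e w → v ≡ w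
Val-functional M (atom P xs) e v≡ w≡ = trans v≡ (sym w≡)
Val-functional M ⊥̇ e v≡ w≡ = trans v≡ (sym w≡)
Val-functional M (φ &̇ ψ) e (_ , _ , φa , ψb , refl) (_ , _ , φa′ , ψb′ , refl) =
  cong₂ _⊛_ (Val-functional M φ e φa φa′) (Val-functional M ψ e ψb ψb′)
Val-functional M (φ ∧̇ ψ) e (_ , _ , φa , ψb , refl) (_ , _ , φa′ , ψb′ , refl) =
  cong₂ _⊓_ (Val-functional M φ e φa φa′) (Val-functional M ψ e ψb ψb′)
Val-functional M (φ →̇ ψ) e (_ , _ , φa , ψb , refl) (_ , _ , φa′ , ψb′ , refl) =
  cong₂ _⇛_ (Val-functional M φ e φa φa′) (Val-functional M ψ e ψb ψb′)
Val-functional M (∀̇ x φ) e (v∈A , v-lower , v-greatest) (w∈A , w-lower , w-greatest) =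
  ℚₚ.≤-antisym (w-greatest _ v∈A v-lower) (v-greatest _ w∈A w-lower)
Val-functional M (∃̇ x φ) e (v∈A , v-upper , v-least) (w∈A , w-upper , w-least) =
  ℚₚ.≤-antisym (v-least _ w∈A w-upper) (w-least _ v∈A v-upper)

Values : ∀ {L A} (M : Structure L A) → ℕ → Formula L → (ℕ → Dom M) → ℚ → Set
Values M x φ e w = Σ (Dom M) λ d → Val M φ (e [ x ↦ d ]) w

record FiniteEmbedding (A B : Chain) : Set where
  field
    size            : ℕ
    source target   : ℕ → ℚ
    source-isChain  : IsFiniteNMChain size source
    target-isChain  : IsFiniteNMChain size target
    source-onto     : ∀ {x} → A x → Σ ℕ λ k → k ℕ.≤ size × x ≡ source k
    source-∈        : ∀ {k} → k ℕ.≤ size → A (source k)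
    target-∈        : ∀ {k} → k ℕ.≤ size → B (target k)
    B⊆[0,1]         : ∀ {u} → B u → 0ℚ ≤ u × u ≤ 1ℚ

module _ {A B : Chain} (E : FiniteEmbedding A B) where
  open FiniteEmbedding E
  private
    module Src = IsFiniteNMChain source-isChain
    module Tgt = IsFiniteNMChain target-isChain

  Corresponding : (ℚ → Set) → (ℚ → Set) → Set
  Corresponding X Y =
    (∀ {w} → X w → Σ ℕ λ j → j ℕ.≤ size × w ≡ source j × Y (target j)) ×
    (∀ {w} → Y w → Σ ℕ λ j → j ℕ.≤ size × w ≡ target j × X (source j))

  IsInf-transfer : ∀ {X Y v} → Corresponding X Y → IsInf A X v →
                   Σ ℕ λ k → k ℕ.≤ size × v ≡ source k × IsInf B Y (target k)
  IsInf-transfer {X} {Y} (X→Y , Y→X) (v∈A , v≤X , v-greatest) with source-onto v∈A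
  ... | k , k≤N , refl = k , k≤N , refl , target-∈ k≤N , lower , greatest
    where
    lower : ∀ w → Y w → target k ≤ w
    lower w Yw with Y→X Yw
    ... | j , j≤N , refl , Xj = Tgt.mono-≤ (Src.cancel-≤ k≤N (v≤X _ Xj)) j≤N

    greatest : ∀ u → B u → (∀ w → Y w → u ≤ w) → u ≤ target k
    greatest u u∈B u≤Y with u ℚₚ.≤? target k
    ... | yes u≤t = u≤t
    ... | no  u≰t =
      ⊥-elim (ℕₚ.<-irrefl refl (Src.cancel-≤ k<N (v-greatest _ (source-∈ k<N) next≤X)))
      where
      t<u : target k < u
      t<u = ℚₚ.≰⇒> u≰t
      k<N : k ℕ.< size
      k<N = Tgt.cancel-< k≤N (subst (target k <_) (sym Tgt.top)
                                     (ℚₚ.<-≤-trans t<u (proj₂ (B⊆[0,1] u∈B))))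
      next≤X : ∀ w → X w → source (suc k) ≤ w
      next≤X w Xw with X→Y Xw
      ... | j , j≤N , refl , Yj = Src.mono-≤ (Tgt.cancel-< k≤N (ℚₚ.<-≤-trans t<u (u≤Y _ Yj))) j≤N

  IsSup-transfer : ∀ {X Y v} → Corresponding X Y → IsSup A X v →
                   Σ ℕ λ k → k ℕ.≤ size × v ≡ source k × IsSup B Y (target k)
  IsSup-transfer {X} {Y} (X→Y , Y→X) (v∈A , X≤v , v-least) with source-onto v∈A
  ... | k , k≤N , refl = k , k≤N , refl , target-∈ k≤N , upper , least
    where
    upper : ∀ w → Y w → w ≤ target k
    upper w Yw with Y→X Yw
    ... | j , j≤N , refl , Xj = Tgt.mono-≤ (Src.cancel-≤ j≤N (X≤v _ Xj)) k≤N

    least : ∀ u → B u → (∀ w → Y w → w ≤ u) → target k ≤ u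
    least u u∈B Y≤u with target k ℚₚ.≤? u
    ... | yes t≤u = t≤u
    ... | no  t≰u = ⊥-elim (ℕₚ.<-irrefl refl (ℕₚ.m≤pred[n]⇒suc[m]≤n k≤pred))
      where
      u<t : u < target k
      u<t = ℚₚ.≰⇒> t≰u
      instance
        k≢0 : ℕ.NonZero k
        k≢0 = ℕ.>-nonZero (Tgt.cancel-< z≤n (subst (_< target k) (sym Tgt.bottom)
                                                    (ℚₚ.≤-<-trans (proj₁ (B⊆[0,1] u∈B)) u<t)))
      pred≤N : ℕ.pred k ℕ.≤ size
      pred≤N = ℕₚ.≤-trans ℕₚ.pred[n]≤n k≤N
      X≤prev : ∀ w → X w → w ≤ source (ℕ.pred k)
      X≤prev w Xw with X→Y Xw
      ... | j , j≤N , refl , Yj =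
        Src.mono-≤ (ℕₚ.<⇒≤pred (Tgt.cancel-< j≤N (ℚₚ.≤-<-trans (Y≤u _ Yj) u<t))) pred≤N
      k≤pred : k ℕ.≤ ℕ.pred k
      k≤pred = Src.cancel-≤ k≤N (v-least _ (source-∈ pred≤N) X≤prev)

  module Pushforward {L : Language} (M : Structure L A) (safe : Safe M) where

    M′ : Structure L B
    M′ = record
      { Dom      = Dom M
      ; inhabit  = inhabit M
      ; interp   = λ P ds → target (proj₁ (source-onto (interp∈A M P ds)))
      ; interp∈A = λ P ds → target-∈ (proj₁ (proj₂ (source-onto (interp∈A M P ds))))
      }

    Translated : Formula L → (ℕ → Dom M) → ℚ → Set
    Translated φ e v = Σ ℕ λ k → k ℕ.≤ size × v ≡ source k × Val M′ φ e (target k)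

    translate₂ : ∀ {φ ψ e a b} (_∙_ : ℚ → ℚ → ℚ) (_∙ᴵ_ : ℕ → ℕ → ℕ) →
      (∀ {i j} → i ℕ.≤ size → j ℕ.≤ size → i ∙ᴵ j ℕ.≤ size) →
      (∀ {f} → IsFiniteNMChain size f →
               ∀ {i j} → i ℕ.≤ size → j ℕ.≤ size → f i ∙ f j ≡ f (i ∙ᴵ j)) →
      Translated φ e a → Translated ψ e b →
      Σ ℕ λ k → k ℕ.≤ size × a ∙ b ≡ source k ×
        Σ ℚ λ a′ → Σ ℚ λ b′ → Val M′ φ e a′ × Val M′ ψ e b′ × target k ≡ a′ ∙ b′
    translate₂ _∙_ _∙ᴵ_ closed homo (i , i≤N , refl , φi) (j , j≤N , refl , ψj) =
      i ∙ᴵ j , closed i≤N j≤N , homo source-isChain i≤N j≤N ,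
      target i , target j , φi , ψj , sym (homo target-isChain i≤N j≤N)

    translate : ∀ φ e {v} → Val M φ e v → Translated φ e v
    correspondence : ∀ x φ e → Corresponding (Values M x φ e) (Values M′ x φ e)

    translate (atom P xs) e refl with source-onto (interp∈A M P (map e xs))
    ... | k , k≤N , v≡ = k , k≤N , v≡ , refl
    translate ⊥̇ e refl = 0 , z≤n , sym Src.bottom , Tgt.bottom
    translate (φ &̇ ψ) e (_ , _ , φa , ψb , refl) =
      translate₂ _⊛_ (conjᴵ size) conjᴵ-≤ IsFiniteNMChain.⊛-homo
                 (translate φ e φa) (translate ψ e ψb)
    translate (φ ∧̇ ψ) e (_ , _ , φa , ψb , refl) =
      translate₂ _⊓_ ℕ._⊓_ ⊓-≤ IsFiniteNMChain.⊓-homo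
                 (translate φ e φa) (translate ψ e ψb)
    translate (φ →̇ ψ) e (_ , _ , φa , ψb , refl) =
      translate₂ _⇛_ (implᴵ size) implᴵ-≤ IsFiniteNMChain.⇛-homo
                 (translate φ e φa) (translate ψ e ψb)
    translate (∀̇ x φ) e v-inf = IsInf-transfer (correspondence x φ e) v-inf
    translate (∃̇ x φ) e v-sup = IsSup-transfer (correspondence x φ e) v-sup

    correspondence x φ e = forward , backward
      where
      forward : ∀ {w} → Values M x φ e w →
                Σ ℕ λ j → j ℕ.≤ size × w ≡ source j × Values M′ x φ e (target j)
      forward (d , φw) =
        let (j , j≤N , w≡ , φj) = translate φ (e [ x ↦ d ]) φw in j , j≤N , w≡ , d , φj

      backward : ∀ {w} → Values M′ x φ e w →
                 Σ ℕ λ j → j ℕ.≤ size × w ≡ target j × Values M x φ e (source j)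
      backward (d , φw) with safe φ (e [ x ↦ d ])
      ... | v , φv with translate φ (e [ x ↦ d ]) φv
      ... | j , j≤N , refl , φj = j , j≤N , Val-functional M′ φ (e [ x ↦ d ]) φw φj , d , φv

    M′-safe : Safe M′
    M′-safe φ e = let (v , φv) = safe φ e ; (k , _ , _ , φk) = translate φ e φv in target k , φk

  ⊨-reflect : ∀ {L} {φ : Formula L} → B ⊨ φ → A ⊨ φ
  ⊨-reflect {φ = φ} B⊨φ M safe e v φv with Pushforward.translate M safe φ e φv
  ... | k , k≤N , refl , φk = begin
    source k     ≡⟨ cong source (Tgt.injective k≤N ℕₚ.≤-refl (trans target-k≡1 (sym Tgt.top))) ⟩
    source size  ≡⟨ Src.top ⟩
    1ℚ           ∎
    where
    open ≡-Reasoning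
    open Pushforward M safe
    target-k≡1 : target k ≡ 1ℚ
    target-k≡1 = B⊨φ M′ M′-safe e (target k) φk

inv-antitone : ∀ {a b} → b ℕ.< a → inv a < inv b
inv-antitone {a} {b} b<a = fraction-mono-< 1 a 1 b
  (subst₂ ℕ._<_ (sym (ℕₚ.*-identityˡ (suc b))) (sym (ℕₚ.*-identityˡ (suc a))) (s≤s b<a))

inv-pos : ∀ k → 0ℚ < inv k
inv-pos k = fraction-mono-< 0 0 1 k (s≤s z≤n)

inv≤1 : ∀ k → inv k ≤ 1ℚ
inv≤1 k = fraction-mono-≤ 1 k 1 0 (s≤s z≤n)

NMinf⊆[0,1] : ∀ {u} → NMinf u → 0ℚ ≤ u × u ≤ 1ℚ
NMinf⊆[0,1] (k , inj₁ refl) = ℚₚ.<⇒≤ (inv-pos k) , inv≤1 k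
NMinf⊆[0,1] (k , inj₂ refl) = sub-antimonoʳ-≤ 1ℚ (inv≤1 k) , sub-antimonoʳ-≤ 1ℚ (ℚₚ.<⇒≤ (inv-pos k))

-- 0, 1/N, 1/(N − 2), 1/(N − 4), … (inv a is 1/(a + 1)).
NMinf-lower : ℕ → ℕ → ℚ
NMinf-lower N zero    = 0ℚ
NMinf-lower N (suc j) = inv (N ∸ suc (j ℕ.+ j))

module _ {N : ℕ} where
  private
    [1+j]+[1+j]≡2+j+j : ∀ j → suc j ℕ.+ suc j ≡ suc (suc (j ℕ.+ j))
    [1+j]+[1+j]≡2+j+j j = cong suc (ℕₚ.+-suc j j)

    1+j+j<N : ∀ {j} → suc j ℕ.+ suc j ℕ.< N → suc (j ℕ.+ j) ℕ.< N
    1+j+j<N {j} lt = ℕₚ.<-trans (ℕₚ.n<1+n _) (subst (ℕ._< N) ([1+j]+[1+j]≡2+j+j j) lt)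

  NMinf-lower-mono : ∀ {j k} → j ℕ.< k → k ℕ.+ k ℕ.< N → NMinf-lower N j < NMinf-lower N k
  NMinf-lower-mono {zero}  {suc k} _ _ = inv-pos (N ∸ suc (k ℕ.+ k))
  NMinf-lower-mono {suc j} {suc k} (s≤s j<k) lt = inv-antitone
    (ℕₚ.∸-monoʳ-< (s≤s (ℕₚ.+-mono-< j<k j<k)) (ℕₚ.<⇒≤ (1+j+j<N lt)))

  NMinf-lower<½ : ∀ {k} → k ℕ.+ k ℕ.< N → NMinf-lower N k < ½
  NMinf-lower<½ {zero}  _  = 0<½
  NMinf-lower<½ {suc k} lt = fraction-mono-< 1 (N ∸ suc (k ℕ.+ k)) 1 1
    (subst (2 ℕ.<_) (sym (ℕₚ.*-identityˡ _)) (s≤s 1<N∸[1+k+k]))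
    where
    1<N∸[1+k+k] : 1 ℕ.< N ∸ suc (k ℕ.+ k)
    1<N∸[1+k+k] = ℕₚ.+-cancelʳ-< (suc (k ℕ.+ k)) 1 (N ∸ suc (k ℕ.+ k))
      (subst (suc (suc (k ℕ.+ k)) ℕ.<_) (sym (ℕₚ.m∸n+n≡m (ℕₚ.<⇒≤ (1+j+j<N lt))))
             (subst (ℕ._< N) ([1+j]+[1+j]≡2+j+j k) lt))

NMinf-lower-∈ : ∀ N k → NMinf (NMinf-lower N k)
NMinf-lower-∈ N zero    = 0 , inj₂ refl
NMinf-lower-∈ N (suc k) = N ∸ suc (k ℕ.+ k) , inj₁ refl

1-NMinf-lower-∈ : ∀ N k → NMinf (1ℚ - NMinf-lower N k)
1-NMinf-lower-∈ N zero    = 0 , inj₁ refl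
1-NMinf-lower-∈ N (suc k) = N ∸ suc (k ℕ.+ k) , inj₂ refl

NMinf'-lower : ℕ → ℚ
NMinf'-lower k = ½ - ½ * inv k

½*inv-pos : ∀ k → 0ℚ < ½ * inv k
½*inv-pos k = ℚₚ.*-monoʳ-<-pos ½ (inv-pos k)

½*inv≤½ : ∀ k → ½ * inv k ≤ ½
½*inv≤½ k = ℚₚ.*-monoˡ-≤-nonNeg ½ (inv≤1 k)

NMinf'-lower-mono : ∀ {j k} → j ℕ.< k → NMinf'-lower j < NMinf'-lower k
NMinf'-lower-mono j<k = sub-antimonoʳ-< ½ (ℚₚ.*-monoʳ-<-pos ½ (inv-antitone j<k))

NMinf'-lower<½ : ∀ k → NMinf'-lower k < ½
NMinf'-lower<½ k = sub-antimonoʳ-< ½ (½*inv-pos k)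

1-[½-p]≡½+p : ∀ p → 1ℚ - (½ - p) ≡ ½ + p
1-[½-p]≡½+p = solve 1 (λ p → con 1ℚ :- (con ½ :- p) := con ½ :+ p) refl
  where open +-*-Solver

NMinf'⊆[0,1] : ∀ {u} → NMinf' u → 0ℚ ≤ u × u ≤ 1ℚ
NMinf'⊆[0,1] (inj₁ (k , inj₁ refl)) =
  sub-antimonoʳ-≤ ½ (½*inv≤½ k) , ℚₚ.≤-trans (ℚₚ.<⇒≤ (NMinf'-lower<½ k)) ½≤1
NMinf'⊆[0,1] (inj₁ (k , inj₂ refl)) =
  ℚₚ.≤-trans (ℚₚ.<⇒≤ 0<½) (ℚₚ.+-monoʳ-≤ ½ (ℚₚ.<⇒≤ (½*inv-pos k))) ,
  ℚₚ.+-monoʳ-≤ ½ (½*inv≤½ k)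
NMinf'⊆[0,1] (inj₂ refl) = ℚₚ.<⇒≤ 0<½ , ½≤1

uniform-embedding : ∀ {B} n {h} → IsFiniteNMChain (suc n) h → (∀ {k} → k ℕ.≤ suc n → B (h k)) →
                    (∀ {u} → B u → 0ℚ ≤ u × u ≤ 1ℚ) → FiniteEmbedding (NMfin (suc (suc n))) B
uniform-embedding n {h} h-isChain h-∈ B⊆[0,1] = record
  { size           = suc n
  ; source         = uniform
  ; target         = h
  ; source-isChain = uniform-isFiniteNMChain
  ; target-isChain = h-isChain
  ; source-onto    = uniform-onto
  ; source-∈       = uniform-∈
  ; target-∈       = h-∈
  ; B⊆[0,1]        = B⊆[0,1]
  }
  where open Uniform n

module NMinfMirror (n : ℕ) = Mirror (suc n) (s≤s z≤n) (NMinf-lower (suc n))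
  NMinf-lower-mono (λ {k} → NMinf-lower<½ {k = k}) refl

module NMinf'Mirror (n : ℕ) = Mirror (suc n) (s≤s z≤n) NMinf'-lower
  (λ j<k _ → NMinf'-lower-mono j<k) (λ {k} _ → NMinf'-lower<½ k) refl

NMinf-mirrored-∈ : ∀ n {k} → k ℕ.≤ suc n → NMinf (NMinfMirror.mirrored n k)
NMinf-mirrored-∈ n = NMinfMirror.mirrored-∈ n NMinf (1 , inj₁ refl)
  (λ {k} _ → NMinf-lower-∈ (suc n) k) (λ {k} _ → 1-NMinf-lower-∈ (suc n) k)

NMinf'-mirrored-∈ : ∀ n {k} → k ℕ.≤ suc n → NMinf' (NMinf'Mirror.mirrored n k)
NMinf'-mirrored-∈ n = NMinf'Mirror.mirrored-∈ n NMinf' (inj₂ refl)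
  (λ {k} _ → inj₁ (k , inj₁ refl)) (λ {k} _ → inj₁ (k , inj₂ (1-[½-p]≡½+p (½ * inv k))))

NMfin↪NMinf : ∀ n → FiniteEmbedding (NMfin (suc (suc n))) NMinf
NMfin↪NMinf n = uniform-embedding n (NMinfMirror.mirrored-isFiniteNMChain n)
  (NMinf-mirrored-∈ n) NMinf⊆[0,1]

NMfin↪NMinf' : ∀ n → FiniteEmbedding (NMfin (suc (suc n))) NMinf'
NMfin↪NMinf' n = uniform-embedding n (NMinf'Mirror.mirrored-isFiniteNMChain n)
  (NMinf'-mirrored-∈ n) NMinf'⊆[0,1]

NMfin↪NMinf⁻ : ∀ n → (∀ k → k ℕ.+ k ≢ suc n) → FiniteEmbedding (NMfin (suc (suc n))) NMinf⁻
NMfin↪NMinf⁻ n N-odd = uniform-embedding n (NMinfMirror.mirrored-isFiniteNMChain n)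
  (λ k≤N → NMinf-mirrored-∈ n k≤N , NMinfMirror.mirrored≢½ n N-odd k≤N) (NMinf⊆[0,1] ∘ proj₁)

NMfin↪NMinf'⁻ : ∀ n → (∀ k → k ℕ.+ k ≢ suc n) → FiniteEmbedding (NMfin (suc (suc n))) NMinf'⁻
NMfin↪NMinf'⁻ n N-odd = uniform-embedding n (NMinf'Mirror.mirrored-isFiniteNMChain n)
  (λ k≤N → NMinf'-mirrored-∈ n k≤N , NMinf'Mirror.mirrored≢½ n N-odd k≤N) (NMinf'⊆[0,1] ∘ proj₁)

1+k+k≢t+t : ∀ k t → suc (k ℕ.+ k) ≢ t ℕ.+ t
1+k+k≢t+t k       zero    ()
1+k+k≢t+t zero    (suc t) eq with trans (ℕₚ.suc-injective eq) (ℕₚ.+-suc t t)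
... | ()
1+k+k≢t+t (suc k) (suc t) eq = 1+k+k≢t+t k t (ℕₚ.suc-injective
  (trans (sym (cong suc (ℕₚ.+-suc k k))) (trans (ℕₚ.suc-injective eq) (ℕₚ.+-suc t t))))

Even[1+n]⇒k+k≢n : ∀ {n} → Even (suc n) → ∀ k → k ℕ.+ k ≢ n
Even[1+n]⇒k+k≢n (t , 1+n≡2t) k k+k≡n =
  1+k+k≢t+t k t (trans (cong suc k+k≡n) (trans 1+n≡2t (cong (t ℕ.+_) (ℕₚ.+-identityʳ t))))

mainTheorem11 : (L : Language) (φ : Formula L) →
    ((n : ℕ) → 1 ℕ.< n → ¬ (NMfin n ⊨ φ) → ¬ (NMinf ⊨ φ) × ¬ (NMinf' ⊨ φ))
    × ((m : ℕ) → 1 ℕ.< m → Even m → ¬ (NMfin m ⊨ φ) → ¬ (NMinf⁻ ⊨ φ) × ¬ (NMinf'⁻ ⊨ φ))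
mainTheorem11 L φ = finite , even
  where
  finite : (n : ℕ) → 1 ℕ.< n → ¬ (NMfin n ⊨ φ) → ¬ (NMinf ⊨ φ) × ¬ (NMinf' ⊨ φ)
  finite (suc zero) (s≤s ())
  finite (suc (suc n)) _ ¬NMfin⊨φ =
    ¬NMfin⊨φ ∘ ⊨-reflect (NMfin↪NMinf n) , ¬NMfin⊨φ ∘ ⊨-reflect (NMfin↪NMinf' n)

  even : (m : ℕ) → 1 ℕ.< m → Even m → ¬ (NMfin m ⊨ φ) → ¬ (NMinf⁻ ⊨ φ) × ¬ (NMinf'⁻ ⊨ φ)
  even (suc zero) (s≤s ())
  even (suc (suc n)) _ m-even ¬NMfin⊨φ =
    ¬NMfin⊨φ ∘ ⊨-reflect (NMfin↪NMinf⁻ n N-odd) , ¬NMfin⊨φ ∘ ⊨-reflect (NMfin↪NMinf'⁻ n N-odd)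
    where
    N-odd : ∀ k → k ℕ.+ k ≢ suc n
    N-odd = Even[1+n]⇒k+k≢n m-even
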